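{- Let \(\vec G\) be a complete-convex oriented graph with underlying graph \(G\). If \(uv\notin E_G\) and \(u\) and \(v\) are the ends of a \(2\)-dipath in \(\vec G\), then both \(\vec G+uv\) (adding the arc from \(u\) to \(v\)) and \(\vec G+vu\) (adding the arc from \(v\) to \(u\)) are complete convex.
   Context: Oriented graphs: anti-symmetric digraphs without parallel arcs. A \(2\)-dipath \(u,x,v\) with centre \(x\): \(ux,xv\) arcs, \(u\ne x\ne v\). A vertex set \(S\) is convex if no vertex outside \(S\) is the centre of a \(2\)-dipath with both ends in \(S\); \(conv(S)\) is the smallest convex superset of \(S\). An oriented graph is complete convex if \(conv(\{u,v\})\) is the whole vertex set for every arc \(uv\). -}

module Defs where

open import Data.Nat using (ℕ)
open import Data.Fin using (Fin)
open import Data.Product using (_×_; ∃)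
open import Data.Sum using (_⊎_)
open import Data.Empty using (⊥)
open import Relation.Nullary using (¬_)
open import Relation.Binary.PropositionalEquality using (_≡_)

Digraph : ℕ → Set₁
Digraph n = Fin n → Fin n → Set

-- Oriented graph: loopless and anti-symmetric (never both uv and vu).
-- (No parallel arcs is automatic for an arc relation.)
IsOriented : ∀ {n} → Digraph n → Set
IsOriented {n} A = (∀ x → ¬ A x x) × (∀ x y → A x y → ¬ A y x)

VSet : ℕ → Set₁
VSet n = Fin n → Set

IsCentreIn : ∀ {n} → Digraph n → VSet n → Fin n → Set
IsCentreIn A S x = ∃ λ u → ∃ λ v → S u × S v × A u x × A x v × ¬ (u ≡ x) × ¬ (x ≡ v)

IsConvex : ∀ {n} → Digraph n → VSet n → Set
IsConvex A S = ∀ x → ¬ S x → ¬ IsCentreIn A S x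

Pair : ∀ {n} → Fin n → Fin n → VSet n
Pair u v x = (x ≡ u) ⊎ (x ≡ v)

-- conv(S) is the whole vertex set: the smallest convex superset of S
-- (the intersection of all convex supersets of S) contains every vertex.
ConvIsAll : ∀ {n} → Digraph n → VSet n → Set₁
ConvIsAll {n} A S = (T : VSet n) → IsConvex A T → (∀ x → S x → T x) → ∀ w → T w

IsCompleteConvex : ∀ {n} → Digraph n → Set₁
IsCompleteConvex A = ∀ u v → A u v → ConvIsAll A (Pair u v)

AddArc : ∀ {n} → Digraph n → Fin n → Fin n → Digraph n
AddArc A u v x y = A x y ⊎ ((x ≡ u) × (y ≡ v))

Is2DipathEnds : ∀ {n} → Digraph n → Fin n → Fin n → Set
Is2DipathEnds A u v =
  ∃ λ x → (A u x × A x v × ¬ (u ≡ x) × ¬ (x ≡ v))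
        ⊎ (A v x × A x u × ¬ (v ≡ x) × ¬ (x ≡ u))

module Submission where

open import Defs
open import Data.Nat using (ℕ)
open import Data.Fin using (Fin)
open import Data.Product using (_×_; _,_)
open import Data.Sum using (_⊎_; inj₁; inj₂)
import Data.Sum as Sum
open import Data.Empty using (⊥-elim)
open import Function using (_∘_)
open import Relation.Nullary using (¬_)
open import Relation.Binary.PropositionalEquality using (_≡_; refl; sym)

-- Adding the arc uv only enlarges the arc relation, so convex sets of G + uv
-- are convex in G and every arc of G still spans everything. For the new arc,
-- convexity of a set T ∋ u, v forces T to contain the centre x of the 2-dipath
-- between u and v, and then T ⊇ conv({u, x}) = V. Constructively, "T contains x"
-- is only obtained as ¬ ¬ T x; complete convexity itself removes the double
-- negation, since {u, x} ∪ {w ∣ P} is convex whenever ¬ ¬ P.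

module _ {n : ℕ} where

  IsConvex-antimono : {A B : Digraph n} → (∀ x y → A x y → B x y) →
                      (T : VSet n) → IsConvex B T → IsConvex A T
  IsConvex-antimono A⊆B T convex y y∉T (a , b , a∈T , b∈T , ay , yb , a≢y , y≢b) =
    convex y y∉T (a , b , a∈T , b∈T , A⊆B a y ay , A⊆B y b yb , a≢y , y≢b)

  ConvIsAll-mono : {A B : Digraph n} → (∀ x y → A x y → B x y) →
                   (S : VSet n) → ConvIsAll A S → ConvIsAll B S
  ConvIsAll-mono A⊆B S all T convex S⊆T = all T (IsConvex-antimono A⊆B T convex) S⊆T

  ConvIsAll-Pair-sym : {A : Digraph n} {a b : Fin n} →
                       ConvIsAll A (Pair a b) → ConvIsAll A (Pair b a)
  ConvIsAll-Pair-sym all T convex ba⊆T = all T convex (λ x → ba⊆T x ∘ Sum.swap)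

  module _ {A : Digraph n} (complete : IsCompleteConvex A) where

    IsCompleteConvex⇒¬¬-elim : ∀ {p c q} → A p c → ¬ q ≡ p → ¬ q ≡ c →
                               (P : Set) → ¬ ¬ P → P
    IsCompleteConvex⇒¬¬-elim {p} {c} {q} pc q≢p q≢c P ¬¬P
      with complete p c pc (λ y → Pair p c y ⊎ P) convex (λ _ → inj₁) q
      where
      convex : IsConvex A (λ y → Pair p c y ⊎ P)
      convex _ y∉T _ = ¬¬P (y∉T ∘ inj₂)
    ... | inj₁ (inj₁ q≡p) = ⊥-elim (q≢p q≡p)
    ... | inj₁ (inj₂ q≡c) = ⊥-elim (q≢c q≡c)
    ... | inj₂ holds = holds

    ConvIsAll-2-dipath-ends : ∀ {p c q} → A p c → A c q → ¬ p ≡ c → ¬ c ≡ q →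
                              ¬ p ≡ q → ConvIsAll A (Pair p q)
    ConvIsAll-2-dipath-ends {p} {c} {q} pc cq p≢c c≢q p≢q T convex pq⊆T =
      complete p c pc T convex pc⊆T
      where
      p∈T : T p
      p∈T = pq⊆T p (inj₁ refl)

      c∈T : T c
      c∈T = IsCompleteConvex⇒¬¬-elim pc (p≢q ∘ sym) (c≢q ∘ sym) (T c) λ c∉T →
        convex c c∉T (p , q , p∈T , pq⊆T q (inj₂ refl) , pc , cq , p≢c , c≢q)

      pc⊆T : ∀ y → Pair p c y → T y
      pc⊆T _ (inj₁ refl) = p∈T
      pc⊆T _ (inj₂ refl) = c∈T

    AddArc-complete-convex : ∀ {a b} → ConvIsAll (AddArc A a b) (Pair a b) →
                             IsCompleteConvex (AddArc A a b)
    AddArc-complete-convex all x y (inj₁ xy) =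
      ConvIsAll-mono (λ _ _ → inj₁) (Pair x y) (complete x y xy)
    AddArc-complete-convex all x y (inj₂ (refl , refl)) = all

    ConvIsAll-2-dipath-ends-AddArc : ∀ {u v} → ¬ u ≡ v → Is2DipathEnds A u v →
                                     (a b : Fin n) → ConvIsAll (AddArc A a b) (Pair u v)
    ConvIsAll-2-dipath-ends-AddArc {u} {v} u≢v (x , inj₁ (ux , xv , u≢x , x≢v)) a b =
      ConvIsAll-mono (λ _ _ → inj₁) (Pair u v)
        (ConvIsAll-2-dipath-ends ux xv u≢x x≢v u≢v)
    ConvIsAll-2-dipath-ends-AddArc {u} {v} u≢v (x , inj₂ (vx , xu , v≢x , x≢u)) a b =
      ConvIsAll-Pair-sym (ConvIsAll-mono (λ _ _ → inj₁) (Pair v u)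
        (ConvIsAll-2-dipath-ends vx xu v≢x x≢u (u≢v ∘ sym)))

theorem11 : ∀ {n} (A : Digraph n) → IsOriented A → IsCompleteConvex A →
            (u v : Fin n) → ¬ (u ≡ v) → ¬ A u v → ¬ A v u → Is2DipathEnds A u v →
            IsCompleteConvex (AddArc A u v) × IsCompleteConvex (AddArc A v u)
theorem11 A _ complete u v u≢v _ _ ends =
    AddArc-complete-convex complete (spans u v)
  , AddArc-complete-convex complete (ConvIsAll-Pair-sym (spans v u))
  where
  spans : ∀ a b → ConvIsAll (AddArc A a b) (Pair u v)
  spans = ConvIsAll-2-dipath-ends-AddArc complete u≢v ends
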